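{- Let $G$ be a cube-free median graph and let $T$ be a tree with gated branches in $G$, rooted at $r$. Let $u$ be a vertex of $G$ and suppose $u$ has two distinct imprints $w^1,w^2$ in $T$. Then $w^1,w^2\in I[r,u]$.
   Context: $d$ is the shortest-path distance in $G$ and $I[a,b]=\{z: d(a,b)=d(a,z)+d(z,b)\}$. A median graph is a connected graph in which $I[a,b]\cap I[b,c]\cap I[c,a]$ is a single vertex for all $a,b,c$; cube-free means no induced 3-cube. A vertex set $X$ is convex if $I[a,b]\subseteq X$ for all $a,b\in X$. A tree with gated branches is a rooted tree $T$ which is a subgraph of $G$ such that every path in $T$ from the root to a leaf has a convex vertex set in $G$. For $v\in V(G)$, a vertex $w\in V(T)$ is an imprint of $v$ in $T$ if $I[v,w]\cap V(T)=\{w\}$. -}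

module Defs where

open import Data.Nat using (ℕ; zero; suc; _+_; _<_; _≤_)
open import Data.Fin using (Fin)
open import Data.Bool using (Bool; true; false; _xor_)
open import Data.Product using (Σ; ∃; ∃-syntax; _×_; _,_)
open import Data.Sum using (_⊎_)
open import Relation.Nullary using (¬_; Dec)
open import Relation.Binary.PropositionalEquality using (_≡_; _≢_)

record Graph (n : ℕ) : Set₁ where
  field
    _~_     : Fin n → Fin n → Set
    ~-dec   : ∀ x y → Dec (x ~ y)
    ~-sym   : ∀ {x y} → x ~ y → y ~ x
    ~-irrefl : ∀ {x} → ¬ (x ~ x)

module _ {n : ℕ} (G : Graph n) where
  open Graph G

  data Walk : Fin n → Fin n → ℕ → Set where
    nil  : ∀ {x} → Walk x x 0
    cons : ∀ {x y z k} → x ~ y → Walk y z k → Walk x z (suc k)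

  Connected : Set
  Connected = ∀ a b → ∃[ k ] Walk a b k

  Dist : Fin n → Fin n → ℕ → Set
  Dist a b k = Walk a b k × (∀ m → Walk a b m → k ≤ m)

  -- z ∈ I[a,b]  iff  d(a,b) = d(a,z) + d(z,b)
  Interval : Fin n → Fin n → Fin n → Set
  Interval a b z = ∃[ k₁ ] ∃[ k₂ ] (Dist a z k₁ × Dist z b k₂ × Dist a b (k₁ + k₂))

  IsMedianGraph : Set
  IsMedianGraph = Connected ×
    (∀ a b c → ∃[ m ] ((Interval a b m × Interval b c m × Interval c a m) ×
                      (∀ m' → Interval a b m' → Interval b c m' → Interval c a m' → m' ≡ m)))

  Q3 : Set
  Q3 = Bool × Bool × Bool

  Q3Adj : Q3 → Q3 → Set
  Q3Adj (a , b , c) (a' , b' , c') =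
    ((a xor a') , (b xor b') , (c xor c')) ≡ (true , false , false) ⊎
    (((a xor a') , (b xor b') , (c xor c')) ≡ (false , true , false) ⊎
     ((a xor a') , (b xor b') , (c xor c')) ≡ (false , false , true))

  InducedCube : Set
  InducedCube = Σ (Q3 → Fin n) λ f →
    (∀ p q → f p ≡ f q → p ≡ q) ×
    (∀ p q → (f p ~ f q → Q3Adj p q) × (Q3Adj p q → f p ~ f q))

  CubeFree : Set
  CubeFree = ¬ InducedCube

  Convex : (Fin n → Set) → Set
  Convex X = ∀ a b z → X a → X b → Interval a b z → X z

  -- A rooted tree T which is a subgraph of G, given by its vertex set, root and
  -- parent map; the depth function guarantees that following parents from any
  -- vertex of T reaches the root (so T is a tree). Edges of T are {x, parent x}.
  record RootedTree : Set₁ where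
    field
      inT       : Fin n → Set
      root      : Fin n
      root-in   : inT root
      parent    : Fin n → Fin n
      depth     : Fin n → ℕ
      parent-in  : ∀ x → inT x → x ≢ root → inT (parent x)
      parent-adj : ∀ x → inT x → x ≢ root → x ~ parent x
      depth-dec  : ∀ x → inT x → x ≢ root → depth (parent x) < depth x

    -- z lies on the path of T from the root to y
    data OnBranch (y : Fin n) : Fin n → Set where
      self : OnBranch y y
      up   : ∀ {z} → inT y → y ≢ root → OnBranch (parent y) z → OnBranch y z

    Leaf : Fin n → Set
    Leaf x = inT x × (∀ y → inT y → y ≢ root → parent y ≢ x)

  open RootedTree public

  HasGatedBranches : RootedTree → Set
  HasGatedBranches T = ∀ l → Leaf T l → Convex (OnBranch T l)

  Imprint : RootedTree → Fin n → Fin n → Set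
  Imprint T v w = inT T w × Interval v w w × (∀ z → Interval v w z → inT T z → z ≡ w)

{-# OPTIONS --safe #-}
-- Let m be the median of r, u and w for an imprint w of u. Since w lies in T it lies on a
-- branch from r to a leaf, and that branch is convex, so m ∈ I[w,r] lies on it and hence
-- in T. But m ∈ I[u,w] as well, and w is the only vertex of T in I[u,w]; so w = m ∈ I[r,u].
module Submission where

open import Defs
open import Level using (0ℓ)
open import Data.Nat using (ℕ; zero; suc; _≤_; _<_; _≤?_)
open import Data.Nat.Induction using (<-wellFounded)
open import Data.Nat.Properties using (≤-refl; ≤-trans; <⇒≤; ≰⇒>; ≤-<-trans; <-irrefl)
open import Data.Fin using (Fin; zero; suc)
open import Data.Fin.Properties using (_≟_)
open import Data.Product using (Σ; _×_; _,_)
open import Data.Sum using (_⊎_; inj₁; inj₂; [_,_]′)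
open import Data.Empty using (⊥-elim)
open import Function using (_∘_)
open import Relation.Nullary using (¬_; yes; no)
open import Relation.Nullary.Decidable using (decidable-stable; ¬¬-excluded-middle)
open import Induction.WellFounded using (Acc; acc)
open import Relation.Unary using (Pred; Decidable; Empty)
open import Relation.Binary.PropositionalEquality using (_≡_; _≢_; refl; subst)

¬¬-decidable : ∀ {n} (P : Pred (Fin n) 0ℓ) → ¬ ¬ Decidable P
¬¬-decidable {zero}  P k = k λ ()
¬¬-decidable {suc n} P k =
  ¬¬-excluded-middle λ P0? →
  ¬¬-decidable (P ∘ suc) λ P∘suc? →
  k λ { zero → P0? ; (suc i) → P∘suc? i }

Maximizer : ∀ {n} → Pred (Fin n) 0ℓ → (Fin n → ℕ) → Set
Maximizer P f = Σ (Fin _) λ y → P y × (∀ z → P z → f z ≤ f y)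

maximizer-or-empty : ∀ {n} {P : Pred (Fin n) 0ℓ} → Decidable P → (f : Fin n → ℕ) →
                     Maximizer P f ⊎ Empty P
maximizer-or-empty {zero} P? f = inj₂ λ ()
maximizer-or-empty {suc n} P? f
  with maximizer-or-empty (P? ∘ suc) (f ∘ suc) | P? zero
... | inj₂ none | no ¬p0 = inj₂ λ { zero → ¬p0 ; (suc z) → none z }
... | inj₂ none | yes p0 = inj₁ (zero , p0 , λ { zero _ → ≤-refl ; (suc z) pz → ⊥-elim (none z pz) })
... | inj₁ (y , py , max) | no ¬p0 = inj₁ (suc y , py , λ { zero p0 → ⊥-elim (¬p0 p0) ; (suc z) pz → max z pz })
... | inj₁ (y , py , max) | yes p0 with f zero ≤? f (suc y)
...   | yes f0≤fy = inj₁ (suc y , py , λ { zero _ → f0≤fy ; (suc z) pz → max z pz })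
...   | no  f0≰fy = inj₁ (zero , p0 , λ { zero _ → ≤-refl ; (suc z) pz → ≤-trans (max z pz) (<⇒≤ (≰⇒> f0≰fy)) })

module _ {n : ℕ} {G : Graph n} (T : RootedTree G) where

  OnBranch⇒inT : ∀ {y z} → inT T y → OnBranch T y z → inT T z
  OnBranch⇒inT y∈T self            = y∈T
  OnBranch⇒inT _   (up y∈T y≢r y⇝z) = OnBranch⇒inT (parent-in T _ y∈T y≢r) y⇝z

  root-on-branch : ∀ {y} → inT T y → OnBranch T y (root T)
  root-on-branch {y} = climb y (<-wellFounded (depth T y))
    where
    climb : ∀ y → Acc _<_ (depth T y) → inT T y → OnBranch T y (root T)
    climb y (acc rs) y∈T with y ≟ root T
    ... | yes refl = self
    ... | no  y≢r  = up y∈T y≢r (climb (parent T y) (rs (depth-dec T y y∈T y≢r)) (parent-in T y y∈T y≢r))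

  -- Membership in T is not assumed decidable, so a deepest vertex above w only exists
  -- under double negation.
  ¬¬-leaf-above : ∀ {w} → inT T w → ¬ ¬ (Σ (Fin n) λ l → Leaf T l × OnBranch T l w)
  ¬¬-leaf-above {w} w∈T k = ¬¬-decidable Above λ Above? →
    [ k ∘ deepest-is-leaf , (λ none → none w (w∈T , self)) ]′ (maximizer-or-empty Above? (depth T))
    where
    Above : Pred (Fin n) 0ℓ
    Above y = inT T y × OnBranch T y w

    deepest-is-leaf : Maximizer Above (depth T) → Σ (Fin n) λ l → Leaf T l × OnBranch T l w
    deepest-is-leaf (l , (l∈T , l⇝w) , deepest) = l , (l∈T , childless) , l⇝w
      where
      childless : ∀ y → inT T y → y ≢ root T → parent T y ≢ l
      childless y y∈T y≢r refl =
        <-irrefl refl (≤-<-trans (deepest y (y∈T , up y∈T y≢r l⇝w)) (depth-dec T y y∈T y≢r))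

Imprint⇒Interval-root : ∀ {n} {G : Graph n} → IsMedianGraph G →
                        (T : RootedTree G) → HasGatedBranches G T →
                        ∀ {u w} → Imprint G T u w → Interval G (root T) u w
Imprint⇒Interval-root {G = G} (_ , median) T gated {u} {w} (w∈T , _ , only-w)
  with median (root T) u w
... | m , (m∈I[r,u] , m∈I[u,w] , m∈I[w,r]) , _ = subst (Interval G (root T) u) m≡w m∈I[r,u]
  where
  m≡w : m ≡ w
  m≡w = decidable-stable (m ≟ w) λ m≢w → ¬¬-leaf-above T w∈T λ { (l , leaf@(l∈T , _) , l⇝w) →
          m≢w (only-w m m∈I[u,w] (OnBranch⇒inT T l∈T
                 (gated l leaf w (root T) m l⇝w (root-on-branch T l∈T) m∈I[w,r]))) }

lemma7 : ∀ {n} (G : Graph n) → IsMedianGraph G → CubeFree G →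
         (T : RootedTree G) → HasGatedBranches G T →
         (u w₁ w₂ : Fin n) → Imprint G T u w₁ → Imprint G T u w₂ → w₁ ≢ w₂ →
         Interval G (root T) u w₁ × Interval G (root T) u w₂
lemma7 G median _ T gated u w₁ w₂ imprint₁ imprint₂ _ =
  Imprint⇒Interval-root median T gated imprint₁ , Imprint⇒Interval-root median T gated imprint₂
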